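{- Let $w\in S_n$ be vexillary. Suppose $(i,j_1),(i,j_2)\in D(w)$ are not linked and $j_1<j_2$, and let $m=r(i,j_2)-r(i,j_1)$. Then $(i-k,j_1)\in D(w)$ for all $0\le k\le m$. Furthermore, $(i-m,j_1)$ and $(i,j_2)$ are linked.
   Context: $w$ is vexillary if it avoids the pattern $2143$. Rothe diagram: $D(w)=\{(i,j)\in[n]\times[n]:i<w^{ -1}(j),\ j<w(i)\}$ ($i$ = row, $j$ = column), with rank function $r(i,j)=|\{k<i:w(k)<j\}|$. Two squares $(i,j),(i',j')\in D(w)$ are linked if $i-i'=r(i,j)-r(i',j')$. -}

module Defs where

open import Data.Nat using (ℕ; zero; suc; _<_; _≤_; _∸_)
open import Data.Nat.Properties using (_<?_)
open import Data.Fin using (Fin; toℕ; fromℕ<)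
open import Data.Fin.Permutation using (Permutation′; _⟨$⟩ʳ_; _⟨$⟩ˡ_)
open import Data.List using (List; length; filter)
open import Data.List using (allFin)
open import Data.Integer using (ℤ; +_; _-_)
open import Data.Product using (Σ; _×_)
open import Relation.Binary.PropositionalEquality using (_≡_)
open import Relation.Nullary using (¬_)

-- Convention: positions 1..n of the paper are encoded 0-based as 0..n-1
-- (Fin n / naturals < n).  All notions below are invariant under this shift.

val : ∀ {n} → Permutation′ n → Fin n → ℕ
val w i = toℕ (w ⟨$⟩ʳ i)

pos : ∀ {n} → Permutation′ n → Fin n → ℕ
pos w j = toℕ (w ⟨$⟩ˡ j)

Vexillary : ∀ {n} → Permutation′ n → Set
Vexillary {n} w = ∀ (a b c d : Fin n) →
  toℕ a < toℕ b → toℕ b < toℕ c → toℕ c < toℕ d →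
  ¬ (val w b < val w a × val w a < val w d × val w d < val w c)

InRothe : ∀ {n} → Permutation′ n → Fin n → Fin n → Set
InRothe w i j = toℕ i < pos w j × toℕ j < val w i

InD : ∀ {n} → Permutation′ n → ℕ → ℕ → Set
InD {n} w i j = Σ (i < n) λ hi → Σ (j < n) λ hj → InRothe w (fromℕ< hi) (fromℕ< hj)

rank : ∀ {n} → Permutation′ n → ℕ → ℕ → ℕ
rank {n} w i j = length (filter (λ k → toℕ k <? i) (filter (λ k → val w k <? j) (allFin n)))

Linked : ∀ {n} → Permutation′ n → ℕ → ℕ → ℕ → ℕ → Set
Linked w i j i' j' = (+ i) - (+ i') ≡ (+ rank w i j) - (+ rank w i' j')

-- Let m = r(i,j₂) − r(i,j₁), the number of rows a < i with j₁ ≤ w(a) < j₂.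
-- If a row c with i − m ≤ c < i had w(c) < j₁, then no row a < c could have
-- j₁ ≤ w(a) < j₂, because a, c, i, w⁻¹(j₂) would form a 2143 pattern; all m
-- such rows would then fit strictly between c and i, where there are fewer
-- than m rows. As w(c) = j₁ is excluded by w⁻¹(j₁) > i, every row
-- i − m ≤ c ≤ i has w(c) > j₁. This puts (c, j₁) in D(w) and gives
-- r(i − m, j₁) = r(i, j₁), from which the linking identity is arithmetic.
module Submission where

open import Defs
open import Level using (0ℓ)
open import Function using (_∘_; id)
open import Data.Nat using (ℕ; zero; suc; _<_; _≤_; _∸_; _+_; z≤n; s≤s; s≤s⁻¹; _≤′_; ≤′-refl; ≤′-step)
open import Data.Nat.Properties
open import Data.Integer as ℤ using (_⊖_)
open import Data.Integer.Properties using (m-n≡m⊖n; +-cancelˡ-⊖)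
open import Data.Fin using (Fin; toℕ; fromℕ<)
open import Data.Fin.Properties using (toℕ-fromℕ<; fromℕ<-toℕ; toℕ<n)
open import Data.Fin.Permutation using (Permutation′; _⟨$⟩ʳ_; _⟨$⟩ˡ_; inverseˡ; inverseʳ)
open import Data.List using ([]; _∷_; [_]; _++_; length; filter; map; upTo; applyUpTo; tabulate; allFin)
open import Data.List.Properties using (upTo-∷ʳ; filter-++; filter-≐; length-++; length-map; map-tabulate; map-upTo)
open import Data.Product using (_×_; _,_; proj₁; proj₂)
open import Data.Sum using (inj₁; inj₂)
open import Data.Empty using (⊥-elim)
open import Relation.Nullary using (¬_; yes; no)
open import Relation.Unary using (Pred; Decidable; _⊆_; _≐_; _∩_; ∁)
open import Relation.Unary.Properties using (_∩?_; ∁?)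
open import Relation.Binary using (tri<; tri≈; tri>)
open import Relation.Binary.PropositionalEquality
  using (_≡_; _≢_; refl; sym; trans; cong; cong₂; subst; subst₂; module ≡-Reasoning)

count : ∀ {p} {P : Pred ℕ p} → Decidable P → ℕ → ℕ
count P? zero = zero
count P? (suc k) with P? k
... | yes _ = suc (count P? k)
... | no _ = count P? k

module _ {p} {P : Pred ℕ p} (P? : Decidable P) where

  count-upTo : ∀ k → length (filter P? (upTo k)) ≡ count P? k
  count-upTo zero = refl
  count-upTo (suc k) = begin
    length (filter P? (upTo (suc k)))                         ≡⟨ cong (length ∘ filter P?) (upTo-∷ʳ k) ⟨
    length (filter P? (upTo k ++ [ k ]))                      ≡⟨ cong length (filter-++ P? (upTo k) [ k ]) ⟩
    length (filter P? (upTo k) ++ filter P? [ k ])            ≡⟨ length-++ (filter P? (upTo k)) ⟩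
    length (filter P? (upTo k)) + length (filter P? [ k ])    ≡⟨ cong (_+ length (filter P? [ k ])) (count-upTo k) ⟩
    count P? k + length (filter P? [ k ])                     ≡⟨ count-suc ⟩
    count P? (suc k)                                          ∎
    where
    open ≡-Reasoning
    count-suc : count P? k + length (filter P? [ k ]) ≡ count P? (suc k)
    count-suc with P? k
    ... | yes _ = +-comm (count P? k) 1
    ... | no _ = +-identityʳ (count P? k)

  count-suc-≤ : ∀ k → count P? (suc k) ≤ suc (count P? k)
  count-suc-≤ k with P? k
  ... | yes _ = ≤-refl
  ... | no _ = n≤1+n (count P? k)

  count-≤-∸ : ∀ {k l} → k ≤ l → count P? l ≤ count P? k + (l ∸ k)
  count-≤-∸ k≤l = go (≤⇒≤′ k≤l)
    where
    go : ∀ {k l} → k ≤′ l → count P? l ≤ count P? k + (l ∸ k)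
    go {k} ≤′-refl = m≤m+n (count P? k) (k ∸ k)
    go {k} {suc l} (≤′-step k≤′l) = begin
      count P? (suc l)              ≤⟨ count-suc-≤ l ⟩
      suc (count P? l)              ≤⟨ s≤s (go k≤′l) ⟩
      suc (count P? k + (l ∸ k))    ≡⟨ +-suc (count P? k) (l ∸ k) ⟨
      count P? k + suc (l ∸ k)      ≡⟨ cong (count P? k +_) (+-∸-assoc 1 (≤′⇒≤ k≤′l)) ⟨
      count P? k + (suc l ∸ k)      ∎
      where open ≤-Reasoning

  count-none : ∀ {k l} → k ≤ l → (∀ a → k ≤ a → a < l → ¬ P a) → count P? l ≡ count P? k
  count-none k≤l = go (≤⇒≤′ k≤l)
    where
    go : ∀ {k l} → k ≤′ l → (∀ a → k ≤ a → a < l → ¬ P a) → count P? l ≡ count P? k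
    go ≤′-refl _ = refl
    go {k} {suc l} (≤′-step k≤′l) none with P? l
    ... | yes Pl = ⊥-elim (none l (≤′⇒≤ k≤′l) ≤-refl Pl)
    ... | no _ = go k≤′l (λ a k≤a a<l → none a k≤a (m<n⇒m<1+n a<l))

  count-∩< : ∀ {k l} → k ≤ l → count (P? ∩? (_<? l)) k ≡ count P? k
  count-∩< {zero} _ = refl
  count-∩< {suc k} {l} k<l with P? k | k <? l
  ... | yes _ | yes _ = cong suc (count-∩< (<⇒≤ k<l))
  ... | yes _ | no k≮l = ⊥-elim (k≮l k<l)
  ... | no _ | _ = count-∩< (<⇒≤ k<l)

  count-split : ∀ {q} {Q : Pred ℕ q} (Q? : Decidable Q) → P ⊆ Q →
    ∀ k → count Q? k ≡ count P? k + count (Q? ∩? ∁? P?) k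
  count-split Q? P⊆Q zero = refl
  count-split Q? P⊆Q (suc k) with P? k | Q? k | count-split Q? P⊆Q k
  ... | yes _ | yes _ | ih = cong suc ih
  ... | yes Pk | no ¬Qk | _ = ⊥-elim (¬Qk (P⊆Q Pk))
  ... | no _ | yes _ | ih = trans (cong suc ih) (sym (+-suc _ _))
  ... | no _ | no _ | ih = ih

module _ {a p q} {A : Set a} {P : Pred A p} {Q : Pred A q} (P? : Decidable P) (Q? : Decidable Q) where

  filter-filter : ∀ xs → filter P? (filter Q? xs) ≡ filter (Q? ∩? P?) xs
  filter-filter [] = refl
  filter-filter (x ∷ xs) with Q? x
  ... | no _ = filter-filter xs
  ... | yes _ with P? x
  ...   | yes _ = cong (x ∷_) (filter-filter xs)
  ...   | no _ = filter-filter xs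

module _ {a b p} {A : Set a} {B : Set b} {P : Pred B p} (P? : Decidable P) (f : A → B) where

  filter-map : ∀ xs → filter P? (map f xs) ≡ map f (filter (P? ∘ f) xs)
  filter-map [] = refl
  filter-map (x ∷ xs) with P? (f x)
  ... | yes _ = cong (f x ∷_) (filter-map xs)
  ... | no _ = filter-map xs

map-toℕ-allFin : ∀ n → map toℕ (allFin n) ≡ upTo n
map-toℕ-allFin zero = refl
map-toℕ-allFin (suc n) = cong (0 ∷_) (begin
  map toℕ (tabulate Fin.suc)        ≡⟨ map-tabulate Fin.suc toℕ ⟩
  tabulate (suc ∘ toℕ)              ≡⟨ map-tabulate toℕ suc ⟨
  map suc (tabulate toℕ)            ≡⟨ cong (map suc) (map-tabulate id toℕ) ⟨
  map suc (map toℕ (allFin n))      ≡⟨ cong (map suc) (map-toℕ-allFin n) ⟩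
  map suc (upTo n)                  ≡⟨ map-upTo suc n ⟩
  applyUpTo suc n                   ∎)
  where open ≡-Reasoning

count-allFin : ∀ {p} {P : Pred ℕ p} (P? : Decidable P) n → length (filter (P? ∘ toℕ) (allFin n)) ≡ count P? n
count-allFin P? n = begin
  length (filter (P? ∘ toℕ) (allFin n))             ≡⟨ length-map toℕ (filter (P? ∘ toℕ) (allFin n)) ⟨
  length (map toℕ (filter (P? ∘ toℕ) (allFin n)))   ≡⟨ cong length (filter-map P? toℕ (allFin n)) ⟨
  length (filter P? (map toℕ (allFin n)))           ≡⟨ cong (length ∘ filter P?) (map-toℕ-allFin n) ⟩
  length (filter P? (upTo n))                       ≡⟨ count-upTo P? n ⟩
  count P? n                                        ∎
  where open ≡-Reasoning

m-[m+n]≡0⊖n : ∀ m n → ℤ.+ m ℤ.- ℤ.+ (m + n) ≡ 0 ⊖ n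
m-[m+n]≡0⊖n m n = begin
  ℤ.+ m ℤ.- ℤ.+ (m + n)  ≡⟨ m-n≡m⊖n m (m + n) ⟩
  m ⊖ (m + n)            ≡⟨ cong (_⊖ (m + n)) (+-identityʳ m) ⟨
  (m + 0) ⊖ (m + n)      ≡⟨ +-cancelˡ-⊖ m 0 n ⟩
  0 ⊖ n                  ∎
  where open ≡-Reasoning

-- Junk value 0 at arguments ≥ n.
extend : ∀ {n} → (Fin n → ℕ) → ℕ → ℕ
extend {n} f a with a <? n
... | yes a<n = f (fromℕ< a<n)
... | no _ = 0

extend-fromℕ< : ∀ {n} (f : Fin n → ℕ) {a} (a<n : a < n) → extend f a ≡ f (fromℕ< a<n)
extend-fromℕ< {n} f {a} a<n with a <? n
... | yes _ = refl
... | no a≮n = ⊥-elim (a≮n a<n)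

extend-toℕ : ∀ {n} (f : Fin n → ℕ) (k : Fin n) → extend f (toℕ k) ≡ f k
extend-toℕ f k = trans (extend-fromℕ< f (toℕ<n k)) (cong f (fromℕ<-toℕ k (toℕ<n k)))

module _ {n} (w : Permutation′ n) where

  value position : ℕ → ℕ
  value = extend (val w)
  position = extend (pos w)

  position-value : ∀ {a} → a < n → position (value a) ≡ a
  position-value {a} a<n = begin
    position (value a)                  ≡⟨ cong position (extend-fromℕ< (val w) a<n) ⟩
    position (toℕ (w ⟨$⟩ʳ A))           ≡⟨ extend-toℕ (pos w) (w ⟨$⟩ʳ A) ⟩
    toℕ (w ⟨$⟩ˡ (w ⟨$⟩ʳ A))             ≡⟨ cong toℕ (inverseˡ w) ⟩
    toℕ A                               ≡⟨ toℕ-fromℕ< a<n ⟩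
    a                                   ∎
    where
    open ≡-Reasoning
    A = fromℕ< a<n

  value-position : ∀ {j} → j < n → value (position j) ≡ j
  value-position {j} j<n = begin
    value (position j)                  ≡⟨ cong value (extend-fromℕ< (pos w) j<n) ⟩
    value (toℕ (w ⟨$⟩ˡ J))              ≡⟨ extend-toℕ (val w) (w ⟨$⟩ˡ J) ⟩
    toℕ (w ⟨$⟩ʳ (w ⟨$⟩ˡ J))             ≡⟨ cong toℕ (inverseʳ w) ⟩
    toℕ J                               ≡⟨ toℕ-fromℕ< j<n ⟩
    j                                   ∎
    where
    open ≡-Reasoning
    J = fromℕ< j<n

  position<n : ∀ {j} → j < n → position j < n
  position<n j<n = subst (_< n) (sym (extend-fromℕ< (pos w) j<n)) (toℕ<n _)

  <position⇒value≢ : ∀ {a j} → a < n → a < position j → value a ≢ j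
  <position⇒value≢ a<n a<pj refl = <-irrefl (sym (position-value a<n)) a<pj

  InD-row<position : ∀ {i j} → InD w i j → i < position j
  InD-row<position (i<n , j<n , i<pj , _) =
    subst₂ _<_ (toℕ-fromℕ< i<n) (sym (extend-fromℕ< (pos w) j<n)) i<pj

  InD-column<value : ∀ {i j} → InD w i j → j < value i
  InD-column<value (i<n , j<n , _ , j<vi) =
    subst₂ _<_ (toℕ-fromℕ< j<n) (sym (extend-fromℕ< (val w) i<n)) j<vi

  InD-intro : ∀ {i j} → i < n → j < n → i < position j → j < value i → InD w i j
  InD-intro i<n j<n i<pj j<vi =
    i<n , j<n , subst₂ _<_ (sym (toℕ-fromℕ< i<n)) (extend-fromℕ< (pos w) j<n) i<pj
              , subst₂ _<_ (sym (toℕ-fromℕ< j<n)) (extend-fromℕ< (val w) i<n) j<vi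

  vexillary-ℕ : Vexillary w → ∀ {a b c d} → a < b → b < c → c < d → d < n →
    ¬ (value b < value a × value a < value d × value d < value c)
  vexillary-ℕ vex a<b b<c c<d d<n (vb<va , va<vd , vd<vc) =
    vex (fromℕ< a<n) (fromℕ< b<n) (fromℕ< c<n) (fromℕ< d<n)
        (row a<n b<n a<b) (row b<n c<n b<c) (row c<n d<n c<d)
        (values b<n a<n vb<va , values a<n d<n va<vd , values d<n c<n vd<vc)
    where
    c<n = <-trans c<d d<n
    b<n = <-trans b<c c<n
    a<n = <-trans a<b b<n
    row : ∀ {x y} (x<n : x < n) (y<n : y < n) → x < y → toℕ (fromℕ< x<n) < toℕ (fromℕ< y<n)
    row x<n y<n = subst₂ _<_ (sym (toℕ-fromℕ< x<n)) (sym (toℕ-fromℕ< y<n))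
    values : ∀ {x y} (x<n : x < n) (y<n : y < n) → value x < value y → val w (fromℕ< x<n) < val w (fromℕ< y<n)
    values x<n y<n = subst₂ _<_ (extend-fromℕ< (val w) x<n) (extend-fromℕ< (val w) y<n)

  Below : ℕ → Pred ℕ 0ℓ
  Below j a = value a < j

  below? : ∀ j → Decidable (Below j)
  below? j a = value a <? j

  rank-count : ∀ {i} j → i ≤ n → rank w i j ≡ count (below? j) i
  rank-count {i} j i≤n = begin
    rank w i j                                                     ≡⟨ cong length (filter-filter row? value? (allFin n)) ⟩
    length (filter (value? ∩? row?) (allFin n))                    ≡⟨ cong length (filter-≐ (value? ∩? row?) (R? ∘ toℕ) toℕ-value (allFin n)) ⟩
    length (filter (R? ∘ toℕ) (allFin n))                          ≡⟨ count-allFin R? n ⟩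
    count R? n                                                     ≡⟨ count-none R? i≤n (λ a i≤a _ (_ , a<i) → <⇒≱ a<i i≤a) ⟩
    count R? i                                                     ≡⟨ count-∩< (below? j) (≤-refl {i}) ⟩
    count (below? j) i                                             ∎
    where
    open ≡-Reasoning
    row? : Decidable (λ k → toℕ k < i)
    row? k = toℕ k <? i
    value? : Decidable (λ k → val w k < j)
    value? k = val w k <? j
    R? = below? j ∩? (_<? i)
    toℕ-value : (λ k → val w k < j × toℕ k < i) ≐ (λ k → value (toℕ k) < j × toℕ k < i)
    toℕ-value = (λ {k} (v<j , k<i) → subst (_< j) (sym (extend-toℕ (val w) k)) v<j , k<i)
              , (λ {k} (v<j , k<i) → subst (_< j) (extend-toℕ (val w) k) v<j , k<i)

  Between : ℕ → ℕ → Pred ℕ 0ℓ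
  Between j₁ j₂ = Below j₂ ∩ ∁ (Below j₁)

  between? : ∀ j₁ j₂ → Decidable (Between j₁ j₂)
  between? j₁ j₂ = below? j₂ ∩? ∁? (below? j₁)

  count-between : ℕ → ℕ → ℕ → ℕ
  count-between i j₁ j₂ = count (between? j₁ j₂) i

  count-between≤ : ∀ i j₁ j₂ → count-between i j₁ j₂ ≤ i
  count-between≤ i j₁ j₂ = count-≤-∸ (between? j₁ j₂) z≤n

  rank-split : ∀ {i j₁ j₂} → j₁ ≤ j₂ → i ≤ n → rank w i j₂ ≡ rank w i j₁ + count-between i j₁ j₂
  rank-split {i} {j₁} {j₂} j₁≤j₂ i≤n = begin
    rank w i j₂                                  ≡⟨ rank-count j₂ i≤n ⟩
    count (below? j₂) i                          ≡⟨ count-split (below? j₁) (below? j₂) (λ v<j₁ → <-≤-trans v<j₁ j₁≤j₂) i ⟩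
    count (below? j₁) i + count-between i j₁ j₂  ≡⟨ cong (_+ count-between i j₁ j₂) (rank-count j₁ i≤n) ⟨
    rank w i j₁ + count-between i j₁ j₂          ∎
    where open ≡-Reasoning

  no-between-above : Vexillary w → ∀ {i j₁ j₂ c} → InD w i j₂ → c < i → value c < j₁ →
    ∀ a → a ≤ c → ¬ Between j₁ j₂ a
  no-between-above vex {i} {j₁} {j₂} {c} D₂ c<i vc<j₁ a a≤c (va<j₂ , va≮j₁) with m≤n⇒m<n∨m≡n a≤c
  ... | inj₂ refl = va≮j₁ vc<j₁
  ... | inj₁ a<c = vexillary-ℕ vex a<c c<i (InD-row<position D₂) (position<n j₂<n)
        ( <-≤-trans vc<j₁ (≮⇒≥ va≮j₁)
        , subst (value a <_) (sym (value-position j₂<n)) va<j₂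
        , subst (_< value i) (sym (value-position j₂<n)) (InD-column<value D₂) )
    where j₂<n = proj₁ (proj₂ D₂)

  count-between≤i∸[1+c] : Vexillary w → ∀ {i j₁ j₂ c} → InD w i j₂ → c < i → value c < j₁ →
    count-between i j₁ j₂ ≤ i ∸ suc c
  count-between≤i∸[1+c] vex {i} {j₁} {j₂} {c} D₂ c<i vc<j₁ = begin
    count-between i j₁ j₂                                ≤⟨ count-≤-∸ (between? j₁ j₂) c<i ⟩
    count (between? j₁ j₂) (suc c) + (i ∸ suc c)         ≡⟨ cong (_+ (i ∸ suc c)) none-up-to-c ⟩
    i ∸ suc c                                            ∎
    where
    open ≤-Reasoning
    none-up-to-c : count (between? j₁ j₂) (suc c) ≡ 0
    none-up-to-c = count-none (between? j₁ j₂) z≤n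
      (λ a _ a<1+c → no-between-above vex D₂ c<i vc<j₁ a (s≤s⁻¹ a<1+c))

  column<value-above : Vexillary w → ∀ {i j₁ j₂ c} → InD w i j₁ → InD w i j₂ →
    i ∸ count-between i j₁ j₂ ≤ c → c ≤ i → j₁ < value c
  column<value-above vex {i} {j₁} {j₂} {c} D₁ D₂ i∸m≤c c≤i with m≤n⇒m<n∨m≡n c≤i
  ... | inj₂ refl = InD-column<value D₁
  ... | inj₁ c<i with <-cmp (value c) j₁
  ...   | tri> _ _ j₁<vc = j₁<vc
  ...   | tri≈ _ vc≡j₁ _ = ⊥-elim (<position⇒value≢ (<-trans c<i (proj₁ D₁)) (<-trans c<i (InD-row<position D₁)) vc≡j₁)
  ...   | tri< vc<j₁ _ _ = ⊥-elim (<⇒≱ c<i∸m i∸m≤c)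
    where
    open ≤-Reasoning
    c<i∸m : c < i ∸ count-between i j₁ j₂
    c<i∸m = begin-strict
      c                                  <⟨ n<1+n c ⟩
      suc c                              ≡⟨ m∸[m∸n]≡n c<i ⟨
      i ∸ (i ∸ suc c)                    ≤⟨ ∸-monoʳ-≤ i (count-between≤i∸[1+c] vex D₂ c<i vc<j₁) ⟩
      i ∸ count-between i j₁ j₂          ∎

  InD-above : Vexillary w → ∀ {i j₁ j₂ k} → InD w i j₁ → InD w i j₂ →
    k ≤ count-between i j₁ j₂ → InD w (i ∸ k) j₁
  InD-above vex {i} {k = k} D₁ D₂ k≤m =
    InD-intro (≤-<-trans i∸k≤i (proj₁ D₁)) (proj₁ (proj₂ D₁))
              (≤-<-trans i∸k≤i (InD-row<position D₁))
              (column<value-above vex D₁ D₂ (∸-monoʳ-≤ i k≤m) i∸k≤i)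
    where i∸k≤i = m∸n≤m i k

  rank-above : Vexillary w → ∀ {i j₁ j₂} → InD w i j₁ → InD w i j₂ →
    rank w (i ∸ count-between i j₁ j₂) j₁ ≡ rank w i j₁
  rank-above vex {i} {j₁} {j₂} D₁ D₂ = begin
    rank w (i ∸ m) j₁               ≡⟨ rank-count j₁ (≤-trans i∸m≤i i≤n) ⟩
    count (below? j₁) (i ∸ m)       ≡⟨ count-none (below? j₁) i∸m≤i none-below ⟨
    count (below? j₁) i             ≡⟨ rank-count j₁ i≤n ⟨
    rank w i j₁                     ∎
    where
    open ≡-Reasoning
    m = count-between i j₁ j₂
    i≤n = <⇒≤ (proj₁ D₁)
    i∸m≤i = m∸n≤m i m
    none-below : ∀ a → i ∸ m ≤ a → a < i → ¬ Below j₁ a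
    none-below a i∸m≤a a<i = <-asym (column<value-above vex D₁ D₂ i∸m≤a (<⇒≤ a<i))

  linked-above : Vexillary w → ∀ {i j₁ j₂} → j₁ ≤ j₂ → InD w i j₁ → InD w i j₂ →
    Linked w (i ∸ count-between i j₁ j₂) j₁ i j₂
  linked-above vex {i} {j₁} {j₂} j₁≤j₂ D₁ D₂ = begin
    ℤ.+ (i ∸ m) ℤ.- ℤ.+ i                        ≡⟨ cong (λ x → ℤ.+ (i ∸ m) ℤ.- ℤ.+ x) (m∸n+n≡m m≤i) ⟨
    ℤ.+ (i ∸ m) ℤ.- ℤ.+ (i ∸ m + m)              ≡⟨ m-[m+n]≡0⊖n (i ∸ m) m ⟩
    0 ⊖ m                                        ≡⟨ m-[m+n]≡0⊖n (rank w i j₁) m ⟨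
    ℤ.+ rank w i j₁ ℤ.- ℤ.+ (rank w i j₁ + m)    ≡⟨ cong₂ (λ x y → ℤ.+ x ℤ.- ℤ.+ y) rank-i∸m rank-j₂ ⟨
    ℤ.+ rank w (i ∸ m) j₁ ℤ.- ℤ.+ rank w i j₂    ∎
    where
    open ≡-Reasoning
    m = count-between i j₁ j₂
    m≤i = count-between≤ i j₁ j₂
    rank-i∸m = rank-above vex D₁ D₂
    rank-j₂ = rank-split j₁≤j₂ (<⇒≤ (proj₁ D₁))

lemma4p3 : ∀ {n} (w : Permutation′ n) → Vexillary w →
    ∀ (i j₁ j₂ : ℕ) → InD w i j₁ → InD w i j₂ →
    ¬ Linked w i j₁ i j₂ → j₁ < j₂ →
    ((k : ℕ) → k ≤ rank w i j₂ ∸ rank w i j₁ →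
      k ≤ i × InD w (i ∸ k) j₁)
    × (rank w i j₁ ≤ rank w i j₂ × rank w i j₂ ∸ rank w i j₁ ≤ i
       × Linked w (i ∸ (rank w i j₂ ∸ rank w i j₁)) j₁ i j₂)
-- Not being linked only says m ≢ 0, which the argument does not need.
lemma4p3 w vex i j₁ j₂ D₁ D₂ _ j₁<j₂ =
    (λ k k≤gap → let k≤m = ≤-trans k≤gap (≤-reflexive gap) in
       ≤-trans k≤m m≤i , InD-above w vex D₁ D₂ k≤m)
  , subst (rank w i j₁ ≤_) (sym split) (m≤m+n (rank w i j₁) m)
  , subst (_≤ i) (sym gap) m≤i
  , subst (λ x → Linked w (i ∸ x) j₁ i j₂) (sym gap) (linked-above w vex j₁≤j₂ D₁ D₂)
  where
  j₁≤j₂ = <⇒≤ j₁<j₂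
  m = count-between w i j₁ j₂
  m≤i = count-between≤ w i j₁ j₂
  split : rank w i j₂ ≡ rank w i j₁ + m
  split = rank-split w j₁≤j₂ (<⇒≤ (proj₁ D₁))
  gap : rank w i j₂ ∸ rank w i j₁ ≡ m
  gap = trans (cong (_∸ rank w i j₁) split) (m+n∸m≡n (rank w i j₁) m)
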